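{- Let $G$ be a finite group. If $G$ is a DGI-group, then every subgroup of $G$ is a DGI-group; and if $G$ is a GI-group, then every subgroup of $G$ is a GI-group.
   Context: All graphs are finite digraphs without loops or multiple arcs; undirected means the arc relation is symmetric. For a finite group $G$, a core-free subgroup $H$ (containing no nontrivial normal subgroup of $G$) and $S\subseteq G\setminus H$, the coset graph $\mathrm{Cos}(G,H,HSH)$ has vertex set the right cosets of $H$ in $G$, with an arc $Hx\to Hy$ iff $yx^{ -1}\in HSH$. $\mathrm{Cos}(G,H,HSH)$ is a GI-graph of $G$ if for every $T\subseteq G\setminus H$ with $\mathrm{Cos}(G,H,HTH)\cong\mathrm{Cos}(G,H,HSH)$ there is $\tau\in\mathrm{Aut}(G)$ with $H^\tau=H$ and $HS^\tau H=HTH$. $G$ is a DGI-group if every such coset graph of $G$ is a GI-graph of $G$, and a GI-group if every undirected such coset graph of $G$ is a GI-graph of $G$. -}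

module Defs where

open import Data.Nat using (ℕ)
open import Data.Fin using (Fin)
open import Data.Fin.Subset using (Subset; _∈_; _∉_; _⊆_)
open import Data.Product using (Σ; ∃; ∃-syntax; _×_; _,_)
open import Relation.Binary.PropositionalEquality using (_≡_)
open import Algebra.Structures using (IsGroup)
open import Function.Bundles using (_⤖_; _⇔_; Bijection)
open import Function.Definitions using (Injective)

record FinGroup : Set where
  infixl 7 _∙_
  infix 8 _⁻¹
  field
    order   : ℕ
    _∙_     : Fin order → Fin order → Fin order
    ε       : Fin order
    _⁻¹     : Fin order → Fin order
    isGroup : IsGroup _≡_ _∙_ ε _⁻¹

-- Digraphs (loops / multiple arcs are excluded by the coset-graph construction
-- itself, since S ⊆ G ∖ H; arcs form a relation, so no multiple arcs).
record Digraph : Set₁ where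
  field
    V   : Set
    Arc : V → V → Set

open Digraph public

_≅_ : Digraph → Digraph → Set
Γ ≅ Δ = Σ (V Γ ⤖ V Δ) λ φ →
  ∀ u v → Arc Γ u v ⇔ Arc Δ (Bijection.to φ u) (Bijection.to φ v)

Undirected : Digraph → Set
Undirected Γ = ∀ u v → Arc Γ u v → Arc Γ v u

module _ (G : FinGroup) where
  open FinGroup G

  record IsSubgroup (H : Subset order) : Set where
    field
      ε∈   : ε ∈ H
      ∙∈   : ∀ {x y} → x ∈ H → y ∈ H → x ∙ y ∈ H
      ⁻¹∈  : ∀ {x} → x ∈ H → x ⁻¹ ∈ H

  record IsNormalSubgroup (N : Subset order) : Set where
    field
      isSubgroup : IsSubgroup N
      conj∈      : ∀ g {x} → x ∈ N → g ∙ x ∙ g ⁻¹ ∈ N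

  CoreFree : Subset order → Set
  CoreFree H = ∀ N → IsNormalSubgroup N → N ⊆ H → ∀ x → x ∈ N → x ≡ ε

  DisjointFrom : Subset order → Subset order → Set
  DisjointFrom S H = ∀ {x} → x ∈ S → x ∉ H

  DoubleCoset : Subset order → (Fin order → Set) → Fin order → Set
  DoubleCoset H X g = ∃[ h₁ ] ∃[ s ] ∃[ h₂ ]
    (h₁ ∈ H × X s × h₂ ∈ H × g ≡ h₁ ∙ s ∙ h₂)

  IsRightCosetOf : Subset order → Subset order → Fin order → Set
  IsRightCosetOf H C x = ∀ g → g ∈ C ⇔ (∃[ h ] (h ∈ H × g ≡ h ∙ x))

  record RightCoset (H : Subset order) : Set where
    constructor coset
    field
      elems     : Subset order
      .isCoset  : ∃[ x ] IsRightCosetOf H elems x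

  open RightCoset public

  Cos : (H S : Subset order) → Digraph
  Cos H S = record
    { V   = RightCoset H
    ; Arc = λ C D → ∃[ x ] ∃[ y ]
        (IsRightCosetOf H (elems C) x × IsRightCosetOf H (elems D) y ×
         DoubleCoset H (_∈ S) (y ∙ x ⁻¹))
    }

  record Automorphism : Set where
    field
      bij : Fin order ⤖ Fin order
    τ : Fin order → Fin order
    τ = Bijection.to bij
    field
      homo : ∀ x y → τ (x ∙ y) ≡ τ x ∙ τ y

  Image : Automorphism → (Fin order → Set) → Fin order → Set
  Image σ X g = ∃[ x ] (X x × Automorphism.τ σ x ≡ g)

  IsGIGraph : (H S : Subset order) → Set
  IsGIGraph H S = ∀ (T : Subset order) → DisjointFrom T H →
    Cos H T ≅ Cos H S →
    ∃[ σ ] ((∀ g → Image σ (_∈ H) g ⇔ g ∈ H) ×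
            (∀ g → DoubleCoset H (Image σ (_∈ S)) g ⇔ DoubleCoset H (_∈ T) g))

IsDGIGroup : FinGroup → Set
IsDGIGroup G = ∀ (H : Subset (FinGroup.order G)) → IsSubgroup G H → CoreFree G H →
  ∀ (S : Subset (FinGroup.order G)) → DisjointFrom G S H → IsGIGraph G H S

IsGIGroup : FinGroup → Set
IsGIGroup G = ∀ (H : Subset (FinGroup.order G)) → IsSubgroup G H → CoreFree G H →
  ∀ (S : Subset (FinGroup.order G)) → DisjointFrom G S H →
  Undirected (Cos G H S) → IsGIGraph G H S

record SubgroupEmbedding (K G : FinGroup) : Set where
  private
    module K = FinGroup K
    module G = FinGroup G
  field
    ι      : Fin K.order → Fin G.order
    inj    : Injective _≡_ _≡_ ι
    homo   : ∀ x y → ι (x K.∙ y) ≡ ι x G.∙ ι y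

module Submission where

-- Let K ≤ G and let H be a core-free subgroup of K with connection set S ⊆ K ∖ H. In G, H is still
-- core-free, and two coset graphs of G are built from Cos(K,H,HSH): with connection set S it is the
-- disjoint union of [G : K] copies of Cos(K,H,HSH), and with connection set S ∪ (G ∖ K) any two
-- vertices in different copies are moreover joined. An isomorphism Cos(K,H,HTH) ≅ Cos(K,H,HSH) lifts
-- copywise to isomorphisms of both graphs, so if G is a (D)GI-group we get two automorphisms of G
-- normalising H and carrying the lifted double cosets onto each other. One of them maps K onto K,
-- and its restriction to K is the automorphism witnessing that Cos(K,H,HSH) is a GI-graph of K.

open import Defs
open import Algebra.Bundles using (Group)
open import Algebra.Structures using (IsGroup)
import Algebra.Properties.Group as GroupProperties
open import Data.Bool using (Bool; true; false)
import Data.Bool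
open import Data.Empty using (⊥-elim)
open import Data.Fin using (Fin; _≟_; punchOut)
open import Data.Fin.Properties using (any?; all?; ¬∀⟶∃¬; injective⇒≤; punchOut-injective)
open import Data.Fin.Subset using (Subset; _∈_; _⊆_; _∪_; ∁)
open import Data.Fin.Subset.Properties using (_∈?_; ⊆-antisym; x∈p∪q⁻; x∈p∪q⁺; x∈∁p⇒x∉p; x∉p⇒x∈∁p)
open import Data.Nat using (ℕ; zero; suc)
open import Data.Nat.Properties using (1+n≰n)
open import Data.Product using (Σ; ∃-syntax; _×_; _,_; proj₁; proj₂)
open import Data.Sum using (_⊎_; inj₁; inj₂; [_,_])
open import Data.Vec using (tabulate)
open import Data.Vec.Properties using (≡-dec; lookup∘tabulate; lookup⇒[]=; []=⇒lookup)
open import Function.Bundles using (_⤖_; _⇔_; Bijection; mk⇔; Equivalence)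
open import Function.Definitions using (Injective)
open import Level using (0ℓ)
open import Relation.Binary.PropositionalEquality
  using (_≡_; _≢_; refl; sym; trans; cong; cong₂; subst; subst₂; module ≡-Reasoning)
open import Relation.Nullary using (Dec; yes; no; ¬_; does)
open import Relation.Nullary.Decidable using (recompute; dec-true; _×-dec_)
open import Relation.Unary using (Decidable)

open Equivalence using () renaming (to to ⇒; from to ⇐)

module _ {n : ℕ} {P : Fin n → Set} (P? : Decidable P) where

  toSubset : Subset n
  toSubset = tabulate (λ x → does (P? x))

  ∈-toSubset⁻ : ∀ {x} → x ∈ toSubset → P x
  ∈-toSubset⁻ {x} x∈ with P? x | trans (sym (lookup∘tabulate (λ x → does (P? x)) x)) ([]=⇒lookup x∈)
  ... | yes p | _ = p

  ∈-toSubset⁺ : ∀ {x} → P x → x ∈ toSubset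
  ∈-toSubset⁺ {x} p = lookup⇒[]= x _ (trans (lookup∘tabulate (λ x → does (P? x)) x) (dec-true (P? x) p))

injective⇒surjective : ∀ {n} (f : Fin n → Fin n) → Injective _≡_ _≡_ f → ∀ y → ∃[ x ] (f x ≡ y)
injective⇒surjective {zero}  f f-inj ()
injective⇒surjective {suc n} f f-inj y with any? (λ x → f x ≟ y)
... | yes hit = hit
... | no miss = ⊥-elim (1+n≰n (injective⇒≤ {f = f-avoiding-y} f-avoiding-y-injective))
  where
  f-avoiding-y : Fin (suc n) → Fin n
  f-avoiding-y x = punchOut {i = y} {j = f x} (λ y≡fx → miss (x , sym y≡fx))
  f-avoiding-y-injective : Injective _≡_ _≡_ f-avoiding-y
  f-avoiding-y-injective {x₁} {x₂} eq = f-inj (punchOut-injective {i = y} {j = f x₁} {k = f x₂} _ _ eq)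

module GroupLemmas (G : FinGroup) where
  open FinGroup G public

  El : Set
  El = Fin order

  group : Group 0ℓ 0ℓ
  group = record { isGroup = isGroup }

  open IsGroup isGroup public using (assoc; identityˡ; identityʳ; inverseʳ; _//_)
  open GroupProperties group public
    using (⁻¹-anti-homo-//; inverseʳ-unique; ∙-cancelˡ; //-rightDividesˡ; //-rightDividesʳ; \\-leftDividesʳ)

  //-∙-// : ∀ x y z → (x // y) ∙ (y // z) ≡ x // z
  //-∙-// x y z = trans (assoc x (y ⁻¹) (y // z)) (cong (x ∙_) (\\-leftDividesʳ y (z ⁻¹)))

covering-by-two-subgroups : ∀ (G : FinGroup) {A B : Subset (FinGroup.order G)} → IsSubgroup G A → IsSubgroup G B →
                 (∀ x → x ∈ A ⊎ x ∈ B) → (∀ x → x ∈ A) ⊎ (∀ x → x ∈ B)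
covering-by-two-subgroups G {A} {B} A≤G B≤G A∪B=G with all? (_∈? A) | all? (_∈? B)
... | yes A=G | _       = inj₁ A=G
... | no _    | yes B=G = inj₂ B=G
... | no A≠G  | no B≠G  with ¬∀⟶∃¬ _ _ (_∈? A) A≠G | ¬∀⟶∃¬ _ _ (_∈? B) B≠G
...   | x , x∉A | y , y∉B = ⊥-elim (xy∉A∪B (A∪B=G (x ∙ y)))
  where
  open GroupLemmas G
  module A = IsSubgroup A≤G
  module B = IsSubgroup B≤G
  x∈B : x ∈ B
  x∈B with A∪B=G x
  ... | inj₁ x∈A = ⊥-elim (x∉A x∈A)
  ... | inj₂ x∈B = x∈B
  y∈A : y ∈ A
  y∈A with A∪B=G y
  ... | inj₁ y∈A = y∈A
  ... | inj₂ y∈B = ⊥-elim (y∉B y∈B)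
  xy∉A∪B : ¬ (x ∙ y ∈ A ⊎ x ∙ y ∈ B)
  xy∉A∪B (inj₁ xy∈A) = x∉A (subst (_∈ A) (//-rightDividesʳ y x) (A.∙∈ xy∈A (A.⁻¹∈ y∈A)))
  xy∉A∪B (inj₂ xy∈B) = y∉B (subst (_∈ B) (\\-leftDividesʳ x y) (B.∙∈ (B.⁻¹∈ x∈B) xy∈B))

module Homomorphism (G₁ G₂ : FinGroup) (φ : Fin (FinGroup.order G₁) → Fin (FinGroup.order G₂))
                    (∙-homo : ∀ x y → φ (FinGroup._∙_ G₁ x y) ≡ FinGroup._∙_ G₂ (φ x) (φ y)) where
  private
    module ₁ = GroupLemmas G₁
    module ₂ = GroupLemmas G₂

  ε-homo : φ ₁.ε ≡ ₂.ε
  ε-homo = ₂.∙-cancelˡ (φ ₁.ε) (φ ₁.ε) ₂.ε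
    (trans (sym (∙-homo ₁.ε ₁.ε)) (trans (cong φ (₁.identityˡ ₁.ε)) (sym (₂.identityʳ (φ ₁.ε)))))

  ⁻¹-homo : ∀ x → φ (x ₁.⁻¹) ≡ φ x ₂.⁻¹
  ⁻¹-homo x = ₂.inverseʳ-unique (φ x) (φ (x ₁.⁻¹))
    (trans (sym (∙-homo x (x ₁.⁻¹))) (trans (cong φ (₁.inverseʳ x)) ε-homo))

  //-homo : ∀ x y → φ (x ₁.// y) ≡ φ x ₂.// φ y
  //-homo x y = trans (∙-homo x (y ₁.⁻¹)) (cong (φ x ₂.∙_) (⁻¹-homo y))

  ∙∙-homo : ∀ x y z → φ (x ₁.∙ y ₁.∙ z) ≡ φ x ₂.∙ φ y ₂.∙ φ z
  ∙∙-homo x y z = trans (∙-homo (x ₁.∙ y) z) (cong (₂._∙ φ z) (∙-homo x y))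

  preimage : Subset ₂.order → Subset ₁.order
  preimage N = toSubset (λ a → φ a ∈? N)

  ∈-preimage⁺ : ∀ {N a} → φ a ∈ N → a ∈ preimage N
  ∈-preimage⁺ {N} = ∈-toSubset⁺ (λ a → φ a ∈? N)

  ∈-preimage⁻ : ∀ {N a} → a ∈ preimage N → φ a ∈ N
  ∈-preimage⁻ {N} = ∈-toSubset⁻ (λ a → φ a ∈? N)

  preimage-subgroup : ∀ {N} → IsSubgroup G₂ N → IsSubgroup G₁ (preimage N)
  preimage-subgroup {N} N≤G₂ = record
    { ε∈  = ∈-preimage⁺ (subst (_∈ N) (sym ε-homo) ε∈)
    ; ∙∈  = λ {a} {c} a∈ c∈ → ∈-preimage⁺ (subst (_∈ N) (sym (∙-homo a c)) (∙∈ (∈-preimage⁻ a∈) (∈-preimage⁻ c∈)))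
    ; ⁻¹∈ = λ {a} a∈ → ∈-preimage⁺ (subst (_∈ N) (sym (⁻¹-homo a)) (⁻¹∈ (∈-preimage⁻ a∈)))
    }
    where open IsSubgroup N≤G₂

  preimage-normal : ∀ {N} → IsNormalSubgroup G₂ N → IsNormalSubgroup G₁ (preimage N)
  preimage-normal {N} N⊴G₂ = record
    { isSubgroup = preimage-subgroup isSubgroup
    ; conj∈      = λ c {a} a∈ → ∈-preimage⁺ (subst (_∈ N) (sym (conj-homo c a)) (conj∈ (φ c) (∈-preimage⁻ a∈)))
    }
    where
    open IsNormalSubgroup N⊴G₂
    conj-homo : ∀ c a → φ (c ₁.∙ a ₁.∙ c ₁.⁻¹) ≡ φ c ₂.∙ φ a ₂.∙ φ c ₂.⁻¹
    conj-homo c a = trans (∙∙-homo c a (c ₁.⁻¹)) (cong (φ c ₂.∙ φ a ₂.∙_) (⁻¹-homo c))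

module Cosets (G : FinGroup) (H : Subset (FinGroup.order G)) (H≤G : IsSubgroup G H) where
  open GroupLemmas G
  open IsSubgroup H≤G

  infix 4 _~_
  _~_ : El → El → Set
  x ~ y = x // y ∈ H

  ~-refl : ∀ x → x ~ x
  ~-refl x = subst (_∈ H) (sym (inverseʳ x)) ε∈

  ~-sym : ∀ {x y} → x ~ y → y ~ x
  ~-sym {x} {y} x~y = subst (_∈ H) (⁻¹-anti-homo-// x y) (⁻¹∈ x~y)

  ~-trans : ∀ {x y z} → x ~ y → y ~ z → x ~ z
  ~-trans {x} {y} {z} x~y y~z = subst (_∈ H) (//-∙-// x y z) (∙∈ x~y y~z)

  _~?_ : ∀ x y → Dec (x ~ y)
  x ~? y = (x // y) ∈? H

  h∙x~x : ∀ {h} x → h ∈ H → h ∙ x ~ x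
  h∙x~x {h} x h∈ = subst (_∈ H) (sym (//-rightDividesʳ x h)) h∈

  IsRightCosetOf⇒~ : ∀ {C x} → IsRightCosetOf G H C x → ∀ {g} → g ∈ C → g ~ x
  IsRightCosetOf⇒~ {x = x} C=Hx g∈C with ⇒ (C=Hx _) g∈C
  ... | h , h∈ , refl = h∙x~x x h∈

  ~⇒IsRightCosetOf : ∀ {C x} → IsRightCosetOf G H C x → ∀ {g} → g ~ x → g ∈ C
  ~⇒IsRightCosetOf {x = x} C=Hx {g} g~x = ⇐ (C=Hx g) (g // x , g~x , sym (//-rightDividesˡ x g))

  cosetSet : El → Subset order
  cosetSet x = toSubset (_~? x)

  cosetSet-isRightCoset : ∀ x → IsRightCosetOf G H (cosetSet x) x
  cosetSet-isRightCoset x g = mk⇔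
    (λ g∈ → g // x , ∈-toSubset⁻ (_~? x) g∈ , sym (//-rightDividesˡ x g))
    (λ { (h , h∈ , refl) → ∈-toSubset⁺ (_~? x) (h∙x~x x h∈) })

  IsRightCosetOf⇒≡cosetSet : ∀ {C x} → IsRightCosetOf G H C x → C ≡ cosetSet x
  IsRightCosetOf⇒≡cosetSet {x = x} C=Hx = ⊆-antisym
    (λ g∈C → ∈-toSubset⁺ (_~? x) (IsRightCosetOf⇒~ C=Hx g∈C))
    (λ g∈Hx → ~⇒IsRightCosetOf C=Hx (∈-toSubset⁻ (_~? x) g∈Hx))

  cosetOf : El → RightCoset G H
  cosetOf x = coset (cosetSet x) (x , cosetSet-isRightCoset x)

  cosetOf-≡⇒~ : ∀ {x y} → cosetOf x ≡ cosetOf y → x ~ y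
  cosetOf-≡⇒~ {x} {y} eq = ∈-toSubset⁻ (_~? y) (subst (x ∈_) (cong elems eq) (∈-toSubset⁺ (_~? x) (~-refl x)))

  cosetSet-resp-~ : ∀ {x y} → x ~ y → cosetSet x ≡ cosetSet y
  cosetSet-resp-~ {x} {y} x~y = ⊆-antisym
    (λ g∈ → ∈-toSubset⁺ (_~? y) (~-trans (∈-toSubset⁻ (_~? x) g∈) x~y))
    (λ g∈ → ∈-toSubset⁺ (_~? x) (~-trans (∈-toSubset⁻ (_~? y) g∈) (~-sym x~y)))

  RightCoset-≡ : ∀ {C D : RightCoset G H} → elems C ≡ elems D → C ≡ D
  RightCoset-≡ {coset _ _} {coset _ _} refl = refl

  ~⇒cosetOf-≡ : ∀ {x y} → x ~ y → cosetOf x ≡ cosetOf y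
  ~⇒cosetOf-≡ x~y = RightCoset-≡ (cosetSet-resp-~ x~y)

  -- The witness of a coset is irrelevant, so facts about it are recomputed by decision procedures.
  nonempty : ∀ (C : RightCoset G H) → ∃[ g ] (g ∈ elems C)
  nonempty (coset C C-coset) = recompute (any? (_∈? C))
    (let (x , C=Hx) = C-coset in x , ~⇒IsRightCosetOf C=Hx (~-refl x))

  rep : RightCoset G H → El
  rep C = proj₁ (nonempty C)

  cosetOf-rep : ∀ (C : RightCoset G H) → cosetOf (rep C) ≡ C
  cosetOf-rep C@(coset D D-coset) =
    RightCoset-≡ (recompute (≡-dec Data.Bool._≟_ (cosetSet (rep C)) D) (elems-≡ D-coset))
    where
    elems-≡ : ∃[ x ] IsRightCosetOf G H D x → cosetSet (rep C) ≡ D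
    elems-≡ (x , D=Hx) = sym (trans (IsRightCosetOf⇒≡cosetSet D=Hx)
      (cosetSet-resp-~ (~-sym (IsRightCosetOf⇒~ D=Hx (proj₂ (nonempty C))))))

  rep-cosetOf : ∀ x → rep (cosetOf x) ~ x
  rep-cosetOf x = cosetOf-≡⇒~ (cosetOf-rep (cosetOf x))

  DoubleCoset-absorb : ∀ {X g a b} → DoubleCoset G H X g → a ∈ H → b ∈ H → DoubleCoset G H X (a ∙ g ∙ b)
  DoubleCoset-absorb {X} {g} {a} {b} (h₁ , s , h₂ , h₁∈ , s∈X , h₂∈ , refl) a∈ b∈ =
    a ∙ h₁ , s , h₂ ∙ b , ∙∈ a∈ h₁∈ , s∈X , ∙∈ h₂∈ b∈ , regroup
    where
    open ≡-Reasoning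
    regroup : a ∙ (h₁ ∙ s ∙ h₂) ∙ b ≡ a ∙ h₁ ∙ s ∙ (h₂ ∙ b)
    regroup = begin
      a ∙ (h₁ ∙ s ∙ h₂) ∙ b  ≡⟨ cong (_∙ b) (sym (assoc a (h₁ ∙ s) h₂)) ⟩
      a ∙ (h₁ ∙ s) ∙ h₂ ∙ b  ≡⟨ cong (λ t → t ∙ h₂ ∙ b) (sym (assoc a h₁ s)) ⟩
      a ∙ h₁ ∙ s ∙ h₂ ∙ b    ≡⟨ assoc (a ∙ h₁ ∙ s) h₂ b ⟩
      a ∙ h₁ ∙ s ∙ (h₂ ∙ b)  ∎

  DoubleCoset-resp-~ : ∀ {X x y x′ y′} → x′ ~ x → y′ ~ y →
                       DoubleCoset G H X (y // x) → DoubleCoset G H X (y′ // x′)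
  DoubleCoset-resp-~ {X} {x} {y} {x′} {y′} x′~x y′~y yx⁻¹∈ =
    subst (DoubleCoset G H X) y′x′⁻¹-factors (DoubleCoset-absorb yx⁻¹∈ y′~y (~-sym x′~x))
    where
    y′x′⁻¹-factors : (y′ // y) ∙ (y // x) ∙ (x // x′) ≡ y′ // x′
    y′x′⁻¹-factors = trans (cong (_∙ (x // x′)) (//-∙-// y′ y x)) (//-∙-// y′ x x′)

  ⇒DoubleCoset : ∀ {X : El → Set} {g} → X g → DoubleCoset G H X g
  ⇒DoubleCoset {g = g} g∈X = ε , g , ε , ε∈ , g∈X , ε∈ , sym (trans (identityʳ (ε ∙ g)) (identityˡ g))

  arc-cosetOf⇔ : ∀ S x y → Arc (Cos G H S) (cosetOf x) (cosetOf y) ⇔ DoubleCoset G H (_∈ S) (y // x)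
  arc-cosetOf⇔ S x y = mk⇔
    (λ (x′ , y′ , Hx=Hx′ , Hy=Hy′ , y′x′⁻¹∈) →
       DoubleCoset-resp-~ (representative-~ Hx=Hx′) (representative-~ Hy=Hy′) y′x′⁻¹∈)
    (λ yx⁻¹∈ → x , y , cosetSet-isRightCoset x , cosetSet-isRightCoset y , yx⁻¹∈)
    where
    representative-~ : ∀ {z z′} → IsRightCosetOf G H (cosetSet z) z′ → z ~ z′
    representative-~ {z} Hz=Hz′ = IsRightCosetOf⇒~ Hz=Hz′ (∈-toSubset⁺ (_~? z) (~-refl z))

  arc⇔ : ∀ S (C D : RightCoset G H) → Arc (Cos G H S) C D ⇔ DoubleCoset G H (_∈ S) (rep D // rep C)
  arc⇔ S C D = mk⇔
    (λ C→D → ⇒ (arc-cosetOf⇔ S (rep C) (rep D)) (subst₂ (Arc (Cos G H S)) (sym (cosetOf-rep C)) (sym (cosetOf-rep D)) C→D))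
    (λ d → subst₂ (Arc (Cos G H S)) (cosetOf-rep C) (cosetOf-rep D) (⇐ (arc-cosetOf⇔ S (rep C) (rep D)) d))

  Undirected⇒DoubleCoset-sym : ∀ {S} → Undirected (Cos G H S) →
                               ∀ x y → DoubleCoset G H (_∈ S) (y // x) → DoubleCoset G H (_∈ S) (x // y)
  Undirected⇒DoubleCoset-sym {S} undirected x y d =
    ⇒ (arc-cosetOf⇔ S y x) (undirected (cosetOf x) (cosetOf y) (⇐ (arc-cosetOf⇔ S x y) d))

  DoubleCoset-sym⇒Undirected : ∀ {S} → (∀ x y → DoubleCoset G H (_∈ S) (y // x) → DoubleCoset G H (_∈ S) (x // y)) →
                               Undirected (Cos G H S)
  DoubleCoset-sym⇒Undirected {S} sym-d C D C→D = ⇐ (arc⇔ S D C) (sym-d _ _ (⇒ (arc⇔ S C D) C→D))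

  Image-DoubleCoset⁻ : ∀ (σ : Automorphism G) {P : El → Set} {x} → (∀ y → Image G σ (_∈ H) y ⇔ y ∈ H) →
                       DoubleCoset G H (Image G σ P) (Automorphism.τ σ x) → DoubleCoset G H P x
  Image-DoubleCoset⁻ σ σ[H]=H (g₁ , _ , g₂ , g₁∈ , (s , s∈P , refl) , g₂∈ , σx≡g₁σsg₂)
    with ⇐ (σ[H]=H g₁) g₁∈ | ⇐ (σ[H]=H g₂) g₂∈
  ... | h₁ , h₁∈ , refl | h₂ , h₂∈ , refl =
    h₁ , s , h₂ , h₁∈ , s∈P , h₂∈ , Bijection.injective (Automorphism.bij σ) (trans σx≡g₁σsg₂ (sym (σ.∙∙-homo h₁ s h₂)))
    where module σ = Homomorphism G G (Automorphism.τ σ) (Automorphism.homo σ)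

module CosetGraphIsomorphism
  (G₁ : FinGroup) (H₁ : Subset (FinGroup.order G₁)) (H₁≤G₁ : IsSubgroup G₁ H₁) (S₁ : Subset (FinGroup.order G₁))
  (G₂ : FinGroup) (H₂ : Subset (FinGroup.order G₂)) (H₂≤G₂ : IsSubgroup G₂ H₂) (S₂ : Subset (FinGroup.order G₂))
  where
  private
    module ₁ = GroupLemmas G₁
    module ₂ = GroupLemmas G₂
    module C₁ = Cosets G₁ H₁ H₁≤G₁
    module C₂ = Cosets G₂ H₂ H₂≤G₂

  record RepIso : Set where
    field
      to           : ₁.El → ₂.El
      from         : ₂.El → ₁.El
      to-cong      : ∀ {x y} → x C₁.~ y → to x C₂.~ to y
      to-injective : ∀ {x y} → to x C₂.~ to y → x C₁.~ y
      to-from      : ∀ y → to (from y) C₂.~ y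
      arc⁺         : ∀ x y → DoubleCoset G₁ H₁ (_∈ S₁) (y ₁.// x) → DoubleCoset G₂ H₂ (_∈ S₂) (to y ₂.// to x)
      arc⁻         : ∀ x y → DoubleCoset G₂ H₂ (_∈ S₂) (to y ₂.// to x) → DoubleCoset G₁ H₁ (_∈ S₁) (y ₁.// x)

  RepIso⇒≅ : RepIso → Cos G₁ H₁ S₁ ≅ Cos G₂ H₂ S₂
  RepIso⇒≅ iso = record { to = Φ ; cong = cong Φ ; bijective = Φ-injective , Φ-surjective } , Φ-arcs
    where
    open RepIso iso
    Φ : RightCoset G₁ H₁ → RightCoset G₂ H₂
    Φ C = C₂.cosetOf (to (C₁.rep C))

    Φ-injective : ∀ {C D} → Φ C ≡ Φ D → C ≡ D
    Φ-injective {C} {D} ΦC≡ΦD = begin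
      C                      ≡⟨ C₁.cosetOf-rep C ⟨
      C₁.cosetOf (C₁.rep C)  ≡⟨ C₁.~⇒cosetOf-≡ (to-injective (C₂.cosetOf-≡⇒~ ΦC≡ΦD)) ⟩
      C₁.cosetOf (C₁.rep D)  ≡⟨ C₁.cosetOf-rep D ⟩
      D                      ∎
      where open ≡-Reasoning

    Φ-surjective : ∀ D → ∃[ C ] (∀ {C′} → C′ ≡ C → Φ C′ ≡ D)
    Φ-surjective D = C₁.cosetOf (from (C₂.rep D)) , λ { refl →
      trans (C₂.~⇒cosetOf-≡ (C₂.~-trans (to-cong (C₁.rep-cosetOf _)) (to-from (C₂.rep D)))) (C₂.cosetOf-rep D) }

    Φ-arcs : ∀ C D → Arc (Cos G₁ H₁ S₁) C D ⇔ Arc (Cos G₂ H₂ S₂) (Φ C) (Φ D)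
    Φ-arcs C D = mk⇔
      (λ C→D → ⇐ (C₂.arc-cosetOf⇔ S₂ _ _) (arc⁺ _ _ (⇒ (C₁.arc⇔ S₁ C D) C→D)))
      (λ ΦC→ΦD → ⇐ (C₁.arc⇔ S₁ C D) (arc⁻ _ _ (⇒ (C₂.arc-cosetOf⇔ S₂ _ _) ΦC→ΦD)))

  ≅⇒RepIso : Cos G₁ H₁ S₁ ≅ Cos G₂ H₂ S₂ → RepIso
  ≅⇒RepIso (ψ , ψ-arcs) = record
    { to           = to
    ; from         = from
    ; to-cong      = λ x~y → C₂.cosetOf-≡⇒~ (trans (sym (to-coset _)) (trans (cong ψ′ (C₁.~⇒cosetOf-≡ x~y)) (to-coset _)))
    ; to-injective = λ tx~ty → C₁.cosetOf-≡⇒~ (Bijection.injective ψ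
                       (trans (to-coset _) (trans (C₂.~⇒cosetOf-≡ tx~ty) (sym (to-coset _)))))
    ; to-from      = λ y → C₂.cosetOf-≡⇒~ (trans (sym (to-coset _))
                       (trans (cong ψ′ (C₁.cosetOf-rep _)) (proj₂ (Bijection.surjective ψ (C₂.cosetOf y)) refl)))
    ; arc⁺         = λ x y d → ⇒ (C₂.arc-cosetOf⇔ S₂ _ _)
                       (subst₂ (Arc (Cos G₂ H₂ S₂)) (to-coset x) (to-coset y) (⇒ (ψ-arcs _ _) (⇐ (C₁.arc-cosetOf⇔ S₁ x y) d)))
    ; arc⁻         = λ x y d → ⇒ (C₁.arc-cosetOf⇔ S₁ x y) (⇐ (ψ-arcs _ _)
                       (subst₂ (Arc (Cos G₂ H₂ S₂)) (sym (to-coset x)) (sym (to-coset y)) (⇐ (C₂.arc-cosetOf⇔ S₂ _ _) d)))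
    }
    where
    ψ′ : RightCoset G₁ H₁ → RightCoset G₂ H₂
    ψ′ = Bijection.to ψ
    to : ₁.El → ₂.El
    to x = C₂.rep (ψ′ (C₁.cosetOf x))
    from : ₂.El → ₁.El
    from y = C₁.rep (proj₁ (Bijection.surjective ψ (C₂.cosetOf y)))
    to-coset : ∀ x → ψ′ (C₁.cosetOf x) ≡ C₂.cosetOf (to x)
    to-coset x = sym (C₂.cosetOf-rep _)

GIWitness : (G : FinGroup) (H S T : Subset (FinGroup.order G)) → Set
GIWitness G H S T = ∃[ σ ] ((∀ g → Image G σ (_∈ H) g ⇔ g ∈ H) ×
                            (∀ g → DoubleCoset G H (Image G σ (_∈ S)) g ⇔ DoubleCoset G H (_∈ T) g))

module Embedding (G K : FinGroup) (E : SubgroupEmbedding K G) where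
  module g = GroupLemmas G
  module k = GroupLemmas K
  open SubgroupEmbedding E public
  open Homomorphism K G ι homo public renaming (ε-homo to ι-ε; ⁻¹-homo to ι-⁻¹; //-homo to ι-//; ∙∙-homo to ι-∙∙)

  InK : g.El → Set
  InK x = ∃[ a ] (ι a ≡ x)

  InK? : Decidable InK
  InK? x = any? (λ a → ι a ≟ x)

  InK-ι : ∀ a → InK (ι a)
  InK-ι a = a , refl

  InK-∙ : ∀ {x y} → InK x → InK y → InK (x g.∙ y)
  InK-∙ (a , refl) (c , refl) = a k.∙ c , homo a c

  InK-⁻¹ : ∀ {x} → InK x → InK (x g.⁻¹)
  InK-⁻¹ (a , refl) = a k.⁻¹ , ι-⁻¹ a

  InK-∙ʳ⁻ : ∀ {x} a → InK (x g.∙ ι a) → InK x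
  InK-∙ʳ⁻ {x} a xa∈K = subst InK (g.//-rightDividesʳ (ι a) x) (InK-∙ xa∈K (InK-⁻¹ (InK-ι a)))

  InK-∙ˡ⁻ : ∀ {x} a → InK (ι a g.∙ x) → InK x
  InK-∙ˡ⁻ {x} a ax∈K = subst InK (g.\\-leftDividesʳ (ι a) x) (InK-∙ (InK-⁻¹ (InK-ι a)) ax∈K)

  Kᴳ : Subset g.order
  Kᴳ = toSubset InK?

  Kᴳ≤G : IsSubgroup G Kᴳ
  Kᴳ≤G = record
    { ε∈  = ∈-toSubset⁺ InK? (k.ε , ι-ε)
    ; ∙∈  = λ x∈ y∈ → ∈-toSubset⁺ InK? (InK-∙ (∈-toSubset⁻ InK? x∈) (∈-toSubset⁻ InK? y∈))
    ; ⁻¹∈ = λ x∈ → ∈-toSubset⁺ InK? (InK-⁻¹ (∈-toSubset⁻ InK? x∈))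
    }

  private
    module Kcosets = Cosets G Kᴳ Kᴳ≤G

  -- r x is a fixed representative of the coset Kx, and x = ι (κ x) ∙ r x; (κ x , r x) are the
  -- coordinates of x in which the coset graphs of G are compared with those of K.
  r : g.El → g.El
  r x = Kcosets.rep (Kcosets.cosetOf x)

  InK⇒r-≡ : ∀ {x y} → InK (x g.// y) → r x ≡ r y
  InK⇒r-≡ xy⁻¹∈K = cong Kcosets.rep (Kcosets.~⇒cosetOf-≡ (∈-toSubset⁺ InK? xy⁻¹∈K))

  x∙rx⁻¹∈K : ∀ x → InK (x g.// r x)
  x∙rx⁻¹∈K x = ∈-toSubset⁻ InK? (Kcosets.~-sym (Kcosets.rep-cosetOf x))

  κ : g.El → k.El
  κ x = proj₁ (x∙rx⁻¹∈K x)

  ι∘κ : ∀ x → ι (κ x) ≡ x g.// r x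
  ι∘κ x = proj₂ (x∙rx⁻¹∈K x)

  r-idempotent : ∀ x → r (r x) ≡ r x
  r-idempotent x = InK⇒r-≡ (∈-toSubset⁻ InK? (Kcosets.rep-cosetOf x))

  r-ι∙r : ∀ a x → r (ι a g.∙ r x) ≡ r x
  r-ι∙r a x = trans (InK⇒r-≡ (a , sym (g.//-rightDividesʳ (r x) (ι a)))) (r-idempotent x)

  κ-ι∙r : ∀ a x → κ (ι a g.∙ r x) ≡ a
  κ-ι∙r a x = inj (trans (ι∘κ (ι a g.∙ r x))
    (trans (cong ((ι a g.∙ r x) g.//_) (r-ι∙r a x)) (g.//-rightDividesʳ (r x) (ι a))))

  //-factorisation : ∀ {x y} → r x ≡ r y → y g.// x ≡ ι (κ y k.// κ x)
  //-factorisation {x} {y} rx≡ry = sym (begin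
    ι (κ y k.// κ x)                       ≡⟨ ι-// (κ y) (κ x) ⟩
    ι (κ y) g.// ι (κ x)                   ≡⟨ cong₂ g._//_ (ι∘κ y) (ι∘κ x) ⟩
    (y g.// r y) g.// (x g.// r x)         ≡⟨ cong ((y g.// r y) g.∙_) (g.⁻¹-anti-homo-// x (r x)) ⟩
    (y g.// r y) g.∙ (r x g.// x)          ≡⟨ cong (λ t → (y g.// r y) g.∙ (t g.// x)) rx≡ry ⟩
    (y g.// r y) g.∙ (r y g.// x)          ≡⟨ g.//-∙-// y (r y) x ⟩
    y g.// x                               ∎)
    where open ≡-Reasoning

  ι[_] : Subset k.order → Subset g.order
  ι[ X ] = toSubset (λ x → any? (λ a → (a ∈? X) ×-dec (ι a ≟ x)))

  ∈-ι[]⁻ : ∀ {X x} → x ∈ ι[ X ] → ∃[ a ] (a ∈ X × ι a ≡ x)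
  ∈-ι[]⁻ {X} = ∈-toSubset⁻ (λ x → any? (λ a → (a ∈? X) ×-dec (ι a ≟ x)))

  ∈-ι[]⁺ : ∀ {X a} → a ∈ X → ι a ∈ ι[ X ]
  ∈-ι[]⁺ {X} {a} a∈X = ∈-toSubset⁺ (λ x → any? (λ a → (a ∈? X) ×-dec (ι a ≟ x))) (a , a∈X , refl)

  ι∈-ι[]⁻ : ∀ {X a} → ι a ∈ ι[ X ] → a ∈ X
  ι∈-ι[]⁻ {X} ιa∈ with ∈-ι[]⁻ ιa∈
  ... | c , c∈X , ιc≡ιa = subst (_∈ X) (inj ιc≡ιa) c∈X

  restrict : (σ : Automorphism G) → (∀ a → InK (Automorphism.τ σ (ι a))) →
             Σ (Automorphism K) λ τ → ∀ a → ι (Automorphism.τ τ a) ≡ Automorphism.τ σ (ι a)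
  restrict σ σ[K]⊆K = record { bij = τ-bijection ; homo = τ-homo } , ι∘τ
    where
    σ′ : g.El → g.El
    σ′ = Automorphism.τ σ
    τ : k.El → k.El
    τ a = proj₁ (σ[K]⊆K a)
    ι∘τ : ∀ a → ι (τ a) ≡ σ′ (ι a)
    ι∘τ a = proj₂ (σ[K]⊆K a)
    τ-homo : ∀ a c → τ (a k.∙ c) ≡ τ a k.∙ τ c
    τ-homo a c = inj (begin
      ι (τ (a k.∙ c))           ≡⟨ ι∘τ (a k.∙ c) ⟩
      σ′ (ι (a k.∙ c))          ≡⟨ cong σ′ (homo a c) ⟩
      σ′ (ι a g.∙ ι c)          ≡⟨ Automorphism.homo σ (ι a) (ι c) ⟩
      σ′ (ι a) g.∙ σ′ (ι c)     ≡⟨ cong₂ g._∙_ (ι∘τ a) (ι∘τ c) ⟨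
      ι (τ a) g.∙ ι (τ c)       ≡⟨ homo (τ a) (τ c) ⟨
      ι (τ a k.∙ τ c)           ∎)
      where open ≡-Reasoning
    τ-injective : Injective _≡_ _≡_ τ
    τ-injective {a} {c} τa≡τc = inj (Bijection.injective (Automorphism.bij σ) (trans (sym (ι∘τ a)) (trans (cong ι τa≡τc) (ι∘τ c))))
    τ-bijection : Fin k.order ⤖ Fin k.order
    τ-bijection = record
      { to        = τ
      ; cong      = cong τ
      ; bijective = τ-injective , λ c → let (a , τa≡c) = injective⇒surjective τ τ-injective c in a , λ { refl → τa≡c }
      }

  module Lifting (H : Subset k.order) (H≤K : IsSubgroup K H) where
    private
      module Hk = IsSubgroup H≤K

    H′ : Subset g.order
    H′ = ι[ H ]

    H′⊆K : ∀ {x} → x ∈ H′ → InK x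
    H′⊆K x∈ with ∈-ι[]⁻ x∈
    ... | a , _ , ιa≡x = a , ιa≡x

    H′≤G : IsSubgroup G H′
    H′≤G = record
      { ε∈  = subst (_∈ H′) ι-ε (∈-ι[]⁺ Hk.ε∈)
      ; ∙∈  = λ x∈ y∈ → ∙-closed (∈-ι[]⁻ x∈) (∈-ι[]⁻ y∈)
      ; ⁻¹∈ = λ x∈ → ⁻¹-closed (∈-ι[]⁻ x∈)
      }
      where
      ∙-closed : ∀ {x y} → ∃[ a ] (a ∈ H × ι a ≡ x) → ∃[ c ] (c ∈ H × ι c ≡ y) → x g.∙ y ∈ H′
      ∙-closed (a , a∈ , refl) (c , c∈ , refl) = subst (_∈ H′) (homo a c) (∈-ι[]⁺ (Hk.∙∈ a∈ c∈))
      ⁻¹-closed : ∀ {x} → ∃[ a ] (a ∈ H × ι a ≡ x) → x g.⁻¹ ∈ H′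
      ⁻¹-closed (a , a∈ , refl) = subst (_∈ H′) (ι-⁻¹ a) (∈-ι[]⁺ (Hk.⁻¹∈ a∈))

    module CK = Cosets K H H≤K
    module CG = Cosets G H′ H′≤G

    ~ᴳ⇔ : ∀ {x y} → x CG.~ y ⇔ (r x ≡ r y × κ x CK.~ κ y)
    ~ᴳ⇔ {x} {y} = mk⇔
      (λ x~y → let rx≡ry = InK⇒r-≡ (H′⊆K x~y) in
               rx≡ry , ι∈-ι[]⁻ (subst (_∈ H′) (//-factorisation (sym rx≡ry)) x~y))
      (λ (rx≡ry , κx~κy) → subst (_∈ H′) (sym (//-factorisation (sym rx≡ry))) (∈-ι[]⁺ κx~κy))

    H′-coreFree : CoreFree K H → CoreFree G H′
    H′-coreFree H-coreFree N N⊴G N⊆H′ x x∈N with ∈-ι[]⁻ (N⊆H′ x∈N)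
    ... | a , _ , refl = trans (cong ι (H-coreFree (preimage N) (preimage-normal N⊴G) ι⁻¹[N]⊆H a (∈-preimage⁺ x∈N))) ι-ε
      where
      ι⁻¹[N]⊆H : preimage N ⊆ H
      ι⁻¹[N]⊆H c∈ = ι∈-ι[]⁻ (N⊆H′ (∈-preimage⁻ c∈))

    InK-sandwich⁻ : ∀ {h₁ s h₂} → h₁ ∈ H′ → h₂ ∈ H′ → InK (h₁ g.∙ s g.∙ h₂) → InK s
    InK-sandwich⁻ h₁∈ h₂∈ h₁sh₂∈K with H′⊆K h₁∈ | H′⊆K h₂∈
    ... | a₁ , refl | a₂ , refl = InK-∙ˡ⁻ a₁ (InK-∙ʳ⁻ a₂ h₁sh₂∈K)

    ι-DoubleCoset⁺ : ∀ {Q : k.El → Set} {P : g.El → Set} {a} → (∀ {s} → Q s → P (ι s)) →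
                     DoubleCoset K H Q a → DoubleCoset G H′ P (ι a)
    ι-DoubleCoset⁺ Q⇒P (c₁ , s , c₂ , c₁∈ , s∈Q , c₂∈ , refl) =
      ι c₁ , ι s , ι c₂ , ∈-ι[]⁺ c₁∈ , Q⇒P s∈Q , ∈-ι[]⁺ c₂∈ , ι-∙∙ c₁ s c₂

    ι-DoubleCoset⁻ : ∀ {P : g.El → Set} {Q : k.El → Set} {a} → (∀ {s} → P s → InK s → ∃[ s₀ ] (Q s₀ × ι s₀ ≡ s)) →
                     DoubleCoset G H′ P (ι a) → DoubleCoset K H Q a
    ι-DoubleCoset⁻ {a = a} P∩K⇒Q (h₁ , s , h₂ , h₁∈ , s∈P , h₂∈ , ιa≡h₁sh₂)
      with ∈-ι[]⁻ h₁∈ | ∈-ι[]⁻ h₂∈ | P∩K⇒Q s∈P (InK-sandwich⁻ h₁∈ h₂∈ (subst InK ιa≡h₁sh₂ (InK-ι a)))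
    ... | c₁ , c₁∈ , refl | c₂ , c₂∈ , refl | s₀ , s₀∈Q , refl =
      c₁ , s₀ , c₂ , c₁∈ , s₀∈Q , c₂∈ , inj (trans ιa≡h₁sh₂ (sym (ι-∙∙ c₁ s₀ c₂)))

    -- Cos(G, H′, H′ ι[S] H′) is a disjoint union of copies of Cos(K, H, HSH), one for each right
    -- coset of K; adding G ∖ K to the connection set joins any two vertices in different copies.
    lift : Subset k.order → Bool → Subset g.order
    lift S false = ι[ S ]
    lift S true  = ι[ S ] ∪ ∁ Kᴳ

    ∈-lift⁻ : ∀ {S b x} → x ∈ lift S b → (∃[ a ] (a ∈ S × ι a ≡ x)) ⊎ (b ≡ true × ¬ InK x)
    ∈-lift⁻ {b = false} x∈ = inj₁ (∈-ι[]⁻ x∈)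
    ∈-lift⁻ {S} {true}  x∈ with x∈p∪q⁻ ι[ S ] (∁ Kᴳ) x∈
    ... | inj₁ x∈ιS = inj₁ (∈-ι[]⁻ x∈ιS)
    ... | inj₂ x∈∁K = inj₂ (refl , λ x∈K → x∈∁p⇒x∉p x∈∁K (∈-toSubset⁺ InK? x∈K))

    ι∈-lift⁺ : ∀ {S b a} → a ∈ S → ι a ∈ lift S b
    ι∈-lift⁺ {b = false} a∈S = ∈-ι[]⁺ a∈S
    ι∈-lift⁺ {b = true}  a∈S = x∈p∪q⁺ (inj₁ (∈-ι[]⁺ a∈S))

    ∉K⇒∈-lift : ∀ {S x} → ¬ InK x → x ∈ lift S true
    ∉K⇒∈-lift x∉K = x∈p∪q⁺ (inj₂ (x∉p⇒x∈∁p (λ x∈K → x∉K (∈-toSubset⁻ InK? x∈K))))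

    ∈-lift∩K⁻ : ∀ {S b x} → x ∈ lift S b → InK x → ∃[ a ] (a ∈ S × ι a ≡ x)
    ∈-lift∩K⁻ {b = b} x∈ x∈K with ∈-lift⁻ {b = b} x∈
    ... | inj₁ x∈ιS       = x∈ιS
    ... | inj₂ (_ , x∉K) = ⊥-elim (x∉K x∈K)

    lift-disjoint : ∀ {S} b → DisjointFrom K S H → DisjointFrom G (lift S b) H′
    lift-disjoint b S∩H=∅ x∈ x∈H′ with ∈-lift⁻ {b = b} x∈
    ... | inj₁ (a , a∈S , refl) = S∩H=∅ a∈S (ι∈-ι[]⁻ x∈H′)
    ... | inj₂ (_ , x∉K)        = x∉K (H′⊆K x∈H′)

    ∉K-joined : ∀ {S b z} → ¬ InK z → DoubleCoset G H′ (_∈ lift S b) z → b ≡ true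
    ∉K-joined {b = b} z∉K (h₁ , s , h₂ , h₁∈ , s∈ , h₂∈ , refl) with ∈-lift⁻ {b = b} s∈
    ... | inj₁ (a , _ , refl) = ⊥-elim (z∉K (InK-∙ (InK-∙ (H′⊆K h₁∈) (InK-ι a)) (H′⊆K h₂∈)))
    ... | inj₂ (b≡true , _)   = b≡true

    LiftedArc : Subset k.order → Bool → g.El → g.El → Set
    LiftedArc S b x y = (r x ≡ r y × DoubleCoset K H (_∈ S) (κ y k.// κ x)) ⊎ (b ≡ true × r x ≢ r y)

    lift-arc⇔ : ∀ S b x y → DoubleCoset G H′ (_∈ lift S b) (y g.// x) ⇔ LiftedArc S b x y
    lift-arc⇔ S b x y = mk⇔ forward backward
      where
      rx≢ry⇒∉K : r x ≢ r y → ¬ InK (y g.// x)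
      rx≢ry⇒∉K rx≢ry yx⁻¹∈K = rx≢ry (sym (InK⇒r-≡ yx⁻¹∈K))
      forward : DoubleCoset G H′ (_∈ lift S b) (y g.// x) → LiftedArc S b x y
      forward d = by-cases (r x ≟ r y)
        where
        by-cases : Dec (r x ≡ r y) → LiftedArc S b x y
        by-cases (yes rx≡ry) = inj₁ (rx≡ry , ι-DoubleCoset⁻ (∈-lift∩K⁻ {S} {b})
                                               (subst (DoubleCoset G H′ (_∈ lift S b)) (//-factorisation rx≡ry) d))
        by-cases (no rx≢ry)  = inj₂ (∉K-joined {S} {b} (rx≢ry⇒∉K rx≢ry) d , rx≢ry)
      backward : LiftedArc S b x y → DoubleCoset G H′ (_∈ lift S b) (y g.// x)
      backward (inj₁ (rx≡ry , d)) = subst (DoubleCoset G H′ (_∈ lift S b)) (sym (//-factorisation rx≡ry))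
                                      (ι-DoubleCoset⁺ (ι∈-lift⁺ {S} {b}) d)
      backward (inj₂ (refl , rx≢ry)) = CG.⇒DoubleCoset (∉K⇒∈-lift {S} (rx≢ry⇒∉K rx≢ry))

    LiftedArc-map : ∀ {S T b x y x′ y′} → r x′ ≡ r x → r y′ ≡ r y →
                    (DoubleCoset K H (_∈ T) (κ y k.// κ x) → DoubleCoset K H (_∈ S) (κ y′ k.// κ x′)) →
                    LiftedArc T b x y → LiftedArc S b x′ y′
    LiftedArc-map rx′≡rx ry′≡ry f (inj₁ (rx≡ry , d)) = inj₁ (trans rx′≡rx (trans rx≡ry (sym ry′≡ry)) , f d)
    LiftedArc-map rx′≡rx ry′≡ry f (inj₂ (b≡true , rx≢ry)) =
      inj₂ (b≡true , λ rx′≡ry′ → rx≢ry (trans (sym rx′≡rx) (trans rx′≡ry′ ry′≡ry)))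

    module IsoK (T S : Subset k.order) = CosetGraphIsomorphism K H H≤K T K H H≤K S
    module IsoG (T S : Subset g.order) = CosetGraphIsomorphism G H′ H′≤G T G H′ H′≤G S

    liftMap : (k.El → k.El) → g.El → g.El
    liftMap φ x = ι (φ (κ x)) g.∙ r x

    lift-RepIso : ∀ {T S} b → IsoK.RepIso T S → IsoG.RepIso (lift T b) (lift S b)
    lift-RepIso {T} {S} b iso = record
      { to           = liftMap to
      ; from         = liftMap from
      ; to-cong      = λ x~y → let (rx≡ry , κx~κy) = ⇒ ~ᴳ⇔ x~y in
                         ⇐ ~ᴳ⇔ (trans (r-lift to _) (trans rx≡ry (sym (r-lift to _))) ,
                                subst₂ CK._~_ (sym (κ-lift to _)) (sym (κ-lift to _)) (to-cong κx~κy))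
      ; to-injective = λ tx~ty → let (rtx≡rty , κtx~κty) = ⇒ ~ᴳ⇔ tx~ty in
                         ⇐ ~ᴳ⇔ (trans (sym (r-lift to _)) (trans rtx≡rty (r-lift to _)) ,
                                to-injective (subst₂ CK._~_ (κ-lift to _) (κ-lift to _) κtx~κty))
      ; to-from      = λ y → ⇐ ~ᴳ⇔ (trans (r-lift to _) (r-lift from y) ,
                         subst (CK._~ κ y) (sym (trans (κ-lift to _) (cong to (κ-lift from y)))) (to-from (κ y)))
      ; arc⁺         = λ x y d → ⇐ (lift-arc⇔ S b _ _) (LiftedArc-map {S} {T} {b} (r-lift to x) (r-lift to y)
                         (λ d → subst₂ (λ u v → DoubleCoset K H (_∈ S) (u k.// v)) (sym (κ-lift to y)) (sym (κ-lift to x))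
                                  (arc⁺ (κ x) (κ y) d))
                         (⇒ (lift-arc⇔ T b x y) d))
      ; arc⁻         = λ x y d → ⇐ (lift-arc⇔ T b x y) (LiftedArc-map {T} {S} {b} (sym (r-lift to x)) (sym (r-lift to y))
                         (λ d → arc⁻ (κ x) (κ y)
                                  (subst₂ (λ u v → DoubleCoset K H (_∈ S) (u k.// v)) (κ-lift to y) (κ-lift to x) d))
                         (⇒ (lift-arc⇔ S b _ _) d))
      }
      where
      open IsoK.RepIso T S iso
      r-lift : ∀ φ x → r (liftMap φ x) ≡ r x
      r-lift φ x = r-ι∙r (φ (κ x)) x
      κ-lift : ∀ φ x → κ (liftMap φ x) ≡ φ (κ x)
      κ-lift φ x = κ-ι∙r (φ (κ x)) x

    lift-undirected : ∀ {S} b → Undirected (Cos K H S) → Undirected (Cos G H′ (lift S b))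
    lift-undirected {S} b undirected = CG.DoubleCoset-sym⇒Undirected λ x y d →
      ⇐ (lift-arc⇔ S b y x) (swap (⇒ (lift-arc⇔ S b x y) d))
      where
      swap : ∀ {x y} → LiftedArc S b x y → LiftedArc S b y x
      swap {x} {y} (inj₁ (rx≡ry , d)) = inj₁ (sym rx≡ry , CK.Undirected⇒DoubleCoset-sym undirected (κ x) (κ y) d)
      swap (inj₂ (b≡true , rx≢ry)) = inj₂ (b≡true , λ ry≡rx → rx≢ry (sym ry≡rx))

    module Restriction {S T b} (witness : GIWitness G H′ (lift S b) (lift T b)) where
      private
        σ : Automorphism G
        σ = proj₁ witness
        σ[H′]=H′ : ∀ x → Image G σ (_∈ H′) x ⇔ x ∈ H′
        σ[H′]=H′ = proj₁ (proj₂ witness)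
        σ[D] : ∀ x → DoubleCoset G H′ (Image G σ (_∈ lift S b)) x ⇔ DoubleCoset G H′ (_∈ lift T b) x
        σ[D] = proj₂ (proj₂ witness)
        σ′ : g.El → g.El
        σ′ = Automorphism.τ σ
        module σι = Homomorphism K G (λ a → σ′ (ι a)) (λ a c → trans (cong σ′ (homo a c)) (Automorphism.homo σ (ι a) (ι c)))

      Kσ : Subset k.order
      Kσ = σι.preimage Kᴳ

      Kσ≤K : IsSubgroup K Kσ
      Kσ≤K = σι.preimage-subgroup Kᴳ≤G

      InK⇒∈Kσ : ∀ {a} → InK (σ′ (ι a)) → a ∈ Kσ
      InK⇒∈Kσ σιa∈K = σι.∈-preimage⁺ (∈-toSubset⁺ InK? σιa∈K)

      σ-DoubleCoset : ∀ {s} → s ∈ S → DoubleCoset G H′ (_∈ lift T b) (σ′ (ι s))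
      σ-DoubleCoset s∈S = ⇒ (σ[D] _) (CG.⇒DoubleCoset (ι _ , ι∈-lift⁺ {S} {b} s∈S , refl))

      H⊆Kσ : ∀ {a} → a ∈ H → a ∈ Kσ
      H⊆Kσ a∈H = InK⇒∈Kσ (H′⊆K (⇒ (σ[H′]=H′ _) (_ , ∈-ι[]⁺ a∈H , refl)))

      DoubleCoset⊆Kσ : b ≡ false → ∀ {a} → DoubleCoset K H (_∈ S) a → a ∈ Kσ
      DoubleCoset⊆Kσ refl (h₁ , s , h₂ , h₁∈ , s∈S , h₂∈ , refl) = ∙∈ (∙∈ (H⊆Kσ h₁∈) s∈Kσ) (H⊆Kσ h₂∈)
        where
        open IsSubgroup Kσ≤K
        s∈Kσ : s ∈ Kσ
        s∈Kσ with InK? (σ′ (ι s))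
        ... | yes σιs∈K = InK⇒∈Kσ σιs∈K
        ... | no σιs∉K  with ∉K-joined {T} {false} σιs∉K (σ-DoubleCoset s∈S)
        ...   | ()

      ∉DoubleCoset⊆Kσ : b ≡ true → ∀ {a} → ¬ DoubleCoset K H (_∈ S) a → a ∈ Kσ
      ∉DoubleCoset⊆Kσ refl {a} a∉HSH with InK? (σ′ (ι a))
      ... | yes σιa∈K = InK⇒∈Kσ σιa∈K
      ... | no σιa∉K  = ⊥-elim (a∉HSH (ι-DoubleCoset⁻ (∈-lift∩K⁻ {S} {true}) (CG.Image-DoubleCoset⁻ σ σ[H′]=H′
                          (⇐ (σ[D] _) (CG.⇒DoubleCoset (∉K⇒∈-lift {T} σιa∉K))))))

      restriction : (∀ a → a ∈ Kσ) → GIWitness K H S T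
      restriction K⊆Kσ = τ , τ[H]=H , τ[D]
        where
        τ-with-ι∘τ : Σ (Automorphism K) λ τ → ∀ a → ι (Automorphism.τ τ a) ≡ σ′ (ι a)
        τ-with-ι∘τ = restrict σ (λ a → ∈-toSubset⁻ InK? (σι.∈-preimage⁻ (K⊆Kσ a)))
        τ : Automorphism K
        τ = proj₁ τ-with-ι∘τ
        τ′ : k.El → k.El
        τ′ = Automorphism.τ τ
        ι∘τ : ∀ a → ι (τ′ a) ≡ σ′ (ι a)
        ι∘τ = proj₂ τ-with-ι∘τ

        τ[H]=H : ∀ a → Image K τ (_∈ H) a ⇔ a ∈ H
        τ[H]=H a = mk⇔
          (λ { (h , h∈H , refl) → ι∈-ι[]⁻ (subst (_∈ H′) (sym (ι∘τ h)) (⇒ (σ[H′]=H′ _) (ι h , ∈-ι[]⁺ h∈H , refl))) })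
          (λ a∈H → τ-preimage (⇐ (σ[H′]=H′ (ι a)) (∈-ι[]⁺ a∈H)))
          where
          τ-preimage : Image G σ (_∈ H′) (ι a) → Image K τ (_∈ H) a
          τ-preimage (x , x∈H′ , σx≡ιa) with ∈-ι[]⁻ x∈H′
          ... | h , h∈H , refl = h , h∈H , inj (trans (ι∘τ h) σx≡ιa)

        σ[lift]∩K⁻ : ∀ {u} → Image G σ (_∈ lift S b) u → InK u → ∃[ s ] (Image K τ (_∈ S) s × ι s ≡ u)
        σ[lift]∩K⁻ (v , v∈ , refl) (m , ιm≡σv) with Bijection.surjective (Automorphism.bij τ) m
        ... | m′ , τm′≡m with trans (cong ι (τm′≡m refl)) ιm≡σv
        ... | ιτm′≡σv with Bijection.injective (Automorphism.bij σ) (trans (sym (ι∘τ m′)) ιτm′≡σv)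
        ... | refl with ∈-lift∩K⁻ {S} {b} v∈ (InK-ι m′)
        ... | s , s∈S , ιs≡ιm′ = τ′ m′ , (m′ , subst (_∈ S) (inj ιs≡ιm′) s∈S , refl) , ιτm′≡σv

        τ[D] : ∀ a → DoubleCoset K H (Image K τ (_∈ S)) a ⇔ DoubleCoset K H (_∈ T) a
        τ[D] a = mk⇔
          (λ d → ι-DoubleCoset⁻ (∈-lift∩K⁻ {T} {b}) (⇒ (σ[D] (ι a))
                   (ι-DoubleCoset⁺ (λ { (s , s∈S , refl) → ι s , ι∈-lift⁺ {S} {b} s∈S , sym (ι∘τ s) }) d)))
          (λ d → ι-DoubleCoset⁻ σ[lift]∩K⁻ (⇐ (σ[D] (ι a)) (ι-DoubleCoset⁺ (ι∈-lift⁺ {T} {b}) d)))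

    -- The automorphism obtained from the disjoint union keeps HSH inside K, the one obtained from
    -- the joined graph keeps K ∖ HSH inside K; as K is not a union of two proper subgroups, one of
    -- them keeps all of K inside K and restricts to the automorphism required.
    subgroup-GIGraph : ∀ {S} → (∀ b → IsGIGraph G H′ (lift S b)) → IsGIGraph K H S
    subgroup-GIGraph {S} lift-GI T T∩H=∅ T≅S =
      [ R-false.restriction , R-true.restriction ] (covering-by-two-subgroups K R-false.Kσ≤K R-true.Kσ≤K cover)
      where
      witness : ∀ b → GIWitness G H′ (lift S b) (lift T b)
      witness b = lift-GI b (lift T b) (lift-disjoint b T∩H=∅)
                    (IsoG.RepIso⇒≅ _ _ (lift-RepIso b (IsoK.≅⇒RepIso _ _ T≅S)))
      module R-false = Restriction {S} {T} {false} (witness false)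
      module R-true  = Restriction {S} {T} {true} (witness true)
      cover : ∀ a → a ∈ R-false.Kσ ⊎ a ∈ R-true.Kσ
      cover a = by-cases (a ∈? R-false.Kσ)
        where
        by-cases : Dec (a ∈ R-false.Kσ) → a ∈ R-false.Kσ ⊎ a ∈ R-true.Kσ
        by-cases (yes a∈) = inj₁ a∈
        by-cases (no a∉)  = inj₂ (R-true.∉DoubleCoset⊆Kσ refl (λ a∈HSH → a∉ (R-false.DoubleCoset⊆Kσ refl a∈HSH)))

mainTheorem5 : (G : FinGroup) →
    (IsDGIGroup G → ∀ (K : FinGroup) → SubgroupEmbedding K G → IsDGIGroup K) ×
    (IsGIGroup G → ∀ (K : FinGroup) → SubgroupEmbedding K G → IsGIGroup K)
mainTheorem5 G = DGI-subgroup , GI-subgroup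
  where
  DGI-subgroup : IsDGIGroup G → ∀ (K : FinGroup) → SubgroupEmbedding K G → IsDGIGroup K
  DGI-subgroup G-DGI K K≤G H H≤K H-coreFree S S∩H=∅ = subgroup-GIGraph {S} λ b →
    G-DGI H′ H′≤G (H′-coreFree H-coreFree) (lift S b) (lift-disjoint b S∩H=∅)
    where open Embedding.Lifting G K K≤G H H≤K

  GI-subgroup : IsGIGroup G → ∀ (K : FinGroup) → SubgroupEmbedding K G → IsGIGroup K
  GI-subgroup G-GI K K≤G H H≤K H-coreFree S S∩H=∅ undirected = subgroup-GIGraph {S} λ b →
    G-GI H′ H′≤G (H′-coreFree H-coreFree) (lift S b) (lift-disjoint b S∩H=∅) (lift-undirected b undirected)
    where open Embedding.Lifting G K K≤G H H≤K
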